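{- In a GCR game family in which the players move alternately, let $\widehat{T}(s)$ denote the value of the game started at $s\in\overline{S}$, and define positional strategies $\widehat{\sigma}^1(s)=\arg\min_{s'\in N(s)}\widehat{T}(s')$ for $s\in S^1\setminus S_c$ and $\widehat{\sigma}^2(s)=\arg\max_{s'\in N(s)}\widehat{T}(s')$ for $s\in S^2\setminus S_c$, where $\arg\min$ (resp. $\arg\max$) denotes the first element of $N(s)$, with respect to a fixed total order on $\overline{S}$, attaining the minimum (resp. maximum). Then for every Pursuer strategy $\sigma^1$, every Evader strategy $\sigma^2$ and every $s\in\overline{S}$: $T(\widehat{\sigma}^1,\widehat{\sigma}^2\mid s)\le T(\sigma^1,\widehat{\sigma}^2\mid s)$ and $T(\widehat{\sigma}^1,\widehat{\sigma}^2\mid s)\ge T(\widehat{\sigma}^1,\sigma^2\mid s)$.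
   Context: A GCR game family consists of: finite location sets $V^1,V^2$; nonterminal states $\overline{S}=V^1\times V^2\times\{1,2\}$, where in state $(x^1,x^2,n)$ player $P^n$ has the move ($P^1$ Pursuer, $P^2$ Evader); $S^n=\{(x^1,x^2,n)\}$; a set of capture states $S_c\subseteq\overline{S}$, $S_{nc}=\overline{S}\setminus S_c$; a terminal state $\tau$; for each $s\in S_{nc}$ a nonempty set $N(s)\subseteq\overline{S}$ of possible next states, while $N(s)=\{\tau\}$ for $s\in S_c$ and $N(\tau)=\{\tau\}$. Alternating moves means: for every $s\in S^n\setminus S_c$, $N(s)\subseteq S^{ -n}$, where $-n$ denotes the other player. A (pure) strategy for $P^n$ is a map $\sigma^n$ from finite sequences of states $s_0\dots s_t$ to states with $\sigma^n(s_0\dots s_t)\in N(s_t)$ whenever $s_t\in S^n\setminus S_c$; it is positional if it depends only on the last state. Given strategies and $s_0$, the play is $s_{t+1}=\sigma^n(s_0\dots s_t)$ if $s_t\in S^n\setminus S_c$ and $s_{t+1}=\tau$ if $s_t\in S_c\cup\{\tau\}$. The capture time $T(\sigma^1,\sigma^2\mid s_0)$ is the number of $t$ with $s_t\in S_{nc}$ (the first time a capture state is reached, or $\infty$). For every $s\in\overline{S}$ the game from $s$ has a value, i.e. $\sup_{\sigma^2}\inf_{\sigma^1}T(\sigma^1,\sigma^2\mid s)=\inf_{\sigma^1}\sup_{\sigma^2}T(\sigma^1,\sigma^2\mid s)$; this common quantity in $\mathbb{N}_0\cup\{\infty\}$ is denoted $\widehat{T}(s)$. -}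

module Defs where

open import Level using (0ℓ)
open import Data.Bool using (Bool; true; false; if_then_else_; _∧_; _∨_)
open import Data.Nat using (ℕ; zero; suc; _≤_; _<_; _<ᵇ_; _≡ᵇ_)
open import Data.Fin using (Fin)
open import Data.List using (List; []; _∷_; _++_; [_]; allFin; cartesianProduct; filterᵇ)
open import Data.Product using (Σ; _×_; _,_; proj₁; proj₂)
open import Data.Empty using (⊥)
open import Relation.Nullary using (¬_)
open import Relation.Binary.Core using (Rel)
open import Relation.Binary.Definitions using (tri<; tri≈; tri>)
open import Relation.Binary.Structures using (IsStrictTotalOrder)
open import Relation.Binary.PropositionalEquality using (_≡_)

data ℕ∞ : Set where
  fin : ℕ → ℕ∞
  ∞   : ℕ∞

infix 4 _≤∞_
data _≤∞_ : ℕ∞ → ℕ∞ → Set where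
  fin≤fin : ∀ {m n} → m ≤ n → fin m ≤∞ fin n
  _≤∞∞    : ∀ t → t ≤∞ ∞

_<∞ᵇ_ : ℕ∞ → ℕ∞ → Bool
fin m <∞ᵇ fin n = m <ᵇ n
fin _ <∞ᵇ ∞     = true
∞     <∞ᵇ _     = false

_≡∞ᵇ_ : ℕ∞ → ℕ∞ → Bool
fin m ≡∞ᵇ fin n = m ≡ᵇ n
∞     ≡∞ᵇ ∞     = true
_     ≡∞ᵇ _     = false

-- least upper bound / greatest lower bound of a (functional) relation
-- R a t  ("the quantity indexed by a equals t")
IsLUB : {A : Set} → (A → ℕ∞ → Set) → ℕ∞ → Set
IsLUB {A} R v = (∀ (a : A) t → R a t → t ≤∞ v)
              × (∀ u → (∀ (a : A) t → R a t → t ≤∞ u) → v ≤∞ u)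

IsGLB : {A : Set} → (A → ℕ∞ → Set) → ℕ∞ → Set
IsGLB {A} R v = (∀ (a : A) t → R a t → v ≤∞ t)
              × (∀ u → (∀ (a : A) t → R a t → u ≤∞ t) → u ≤∞ v)

data Player : Set where
  P1 P2 : Player   -- P1 = Pursuer, P2 = Evader

-- V¹ = Fin n1, V² = Fin n2.
-- Nonterminal states S̄ = V¹ × V² × {1,2}; S_c given as a Boolean subset;
-- N s s' = true  means  s' ∈ N(s)  (relevant for s ∈ S_nc; for s ∈ S_c,
-- N(s) = {τ} is built into the play semantics below).

record GCR : Set₁ where
  field
    n1 n2 : ℕ
  NS : Set
  NS = Fin n1 × Fin n2 × Player
  field
    Sc       : NS → Bool
    N        : NS → NS → Bool
    N-nonempty : ∀ s → Sc s ≡ false → Σ NS (λ s' → N s s' ≡ true)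

  owner : NS → Player
  owner (_ , _ , n) = n

  allNS : List NS
  allNS = cartesianProduct (allFin n1) (cartesianProduct (allFin n2) (P1 ∷ P2 ∷ []))

  Alternating : Set
  Alternating = ∀ s s' → Sc s ≡ false → N s s' ≡ true → ¬ (owner s' ≡ owner s)

  data St : Set where
    st : NS → St
    τ  : St

  -- raw strategy: history s₀ … s_{t-1} (chronological) and current state s_t
  RawStrat : Set
  RawStrat = List NS → NS → NS

  IsStrategy : Player → RawStrat → Set
  IsStrategy n σ = ∀ h s → owner s ≡ n → Sc s ≡ false → N s (σ h s) ≡ true

  Strat : Player → Set
  Strat n = Σ RawStrat (IsStrategy n)

  module _ (σ1 σ2 : RawStrat) where
    mover : Player → RawStrat
    mover P1 = σ1
    mover P2 = σ2

    step : List NS → NS → St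
    step h s = if Sc s then τ else st (mover (owner s) h s)

    playFrom : List NS → St → ℕ → St
    playFrom h x        zero    = x
    playFrom h τ        (suc k) = τ
    playFrom h (st s)   (suc k) = playFrom (h ++ [ s ]) (step h s) k

    play : NS → ℕ → St
    play s₀ = playFrom [] (st s₀)

  InSnc : St → Set
  InSnc (st s) = Sc s ≡ false
  InSnc τ      = ⊥

  InSc : St → Set
  InSc (st s) = Sc s ≡ true
  InSc τ      = ⊥

  CaptureTime : RawStrat → RawStrat → NS → ℕ∞ → Set
  CaptureTime σ1 σ2 s (fin k) = (∀ j → j < k → InSnc (play σ1 σ2 s j)) × InSc (play σ1 σ2 s k)
  CaptureTime σ1 σ2 s ∞       = ∀ j → InSnc (play σ1 σ2 s j)

  IsValue : NS → ℕ∞ → Set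
  IsValue s v =
      IsLUB (λ (σ2 : Strat P2) w → IsGLB (λ (σ1 : Strat P1) t → CaptureTime (proj₁ σ1) (proj₁ σ2) s t) w) v
    × IsGLB (λ (σ1 : Strat P1) w → IsLUB (λ (σ2 : Strat P2) t → CaptureTime (proj₁ σ1) (proj₁ σ2) s t) w) v

  module _ {_<ₒ_ : Rel NS 0ℓ} (ord : IsStrictTotalOrder _≡_ _<ₒ_) (V : NS → ℕ∞) where
    earlier : NS → NS → Bool
    earlier a b with IsStrictTotalOrder.compare ord a b
    ... | tri< _ _ _ = true
    ... | tri≈ _ _ _ = false
    ... | tri> _ _ _ = false

    beatsMin beatsMax : NS → NS → Bool
    beatsMin c b = (V c <∞ᵇ V b) ∨ ((V c ≡∞ᵇ V b) ∧ earlier c b)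
    beatsMax c b = (V b <∞ᵇ V c) ∨ ((V c ≡∞ᵇ V b) ∧ earlier c b)

    best : (NS → NS → Bool) → NS → List NS → NS
    best beats b []       = b
    best beats b (y ∷ ys) = best beats (if beats y b then y else b) ys

    -- first element (w.r.t. the order) of N(s) attaining the min/max of V;
    -- default s when N(s) = ∅ (only possible for s ∈ S_c, where it is irrelevant)
    argBest : (NS → NS → Bool) → NS → NS
    argBest beats s with filterᵇ (N s) allNS
    ... | []     = s
    ... | x ∷ xs = best beats x xs

    σ̂1 σ̂2 : RawStrat
    σ̂1 _ s = argBest beatsMin s
    σ̂2 _ s = argBest beatsMax s

module Submission where

-- Call V : S̄ → ℕ ∪ {∞} a pursuer potential for a positional
-- Pursuer move a if every move out of a non-capture state (a's move at
-- Pursuer states, any legal move at Evader states) lowers V by at least one;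
-- then playing a captures every legal Evader within V(s) steps.  Dually, an
-- evader potential for a positional Evader move b is 0 at capture states and
-- drops by at most one along b's moves and along every legal Pursuer move;
-- then playing b survives at least V(s) steps against every legal Pursuer.
--
-- The proposition follows from
--   T(σ̂¹,σ̂²) ≤ T̂ ≤ T(σ¹,σ̂²)   and   T(σ̂¹,σ²) ≤ T̂ ≤ T(σ̂¹,σ̂²).

open import Defs
open import Level using (0ℓ)
open import Data.Bool using (Bool; true; false; T)
open import Data.Bool.Properties using (T-≡)
open import Data.Nat using (ℕ; zero; suc; _≤_; _<_; z≤n; s≤s; _≤?_)
open import Data.Nat.Properties
  using (≤-refl; ≤-trans; <⇒≤; ≰⇒>; ≮⇒≥; 1+n≰n; <ᵇ⇒<; <⇒<ᵇ; ≡ᵇ⇒≡; m<1+n⇒m<n∨m≡n)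
open import Data.List using ([]; _∷_; _++_; [_]; filterᵇ)
open import Data.List.Relation.Unary.All as All using (All; []; _∷_)
open import Data.List.Relation.Unary.All.Properties using (all-filter)
open import Data.List.Relation.Unary.Any using (here; there)
open import Data.List.Membership.Propositional using (_∈_)
open import Data.List.Membership.Propositional.Properties using (∈-filter⁺; ∈-cartesianProduct⁺; ∈-allFin)
open import Data.Product using (Σ; _×_; _,_; proj₁; proj₂)
open import Data.Sum using (_⊎_; inj₁; inj₂)
open import Data.Empty using (⊥-elim)
open import Function using (flip)
open import Function.Bundles using (module Equivalence)
open import Relation.Nullary using (¬_; Dec; yes; no)
open import Relation.Nullary.Negation using (Stable)
open import Relation.Nullary.Decidable using (decidable-stable; T?)
open import Relation.Binary.Core using (Rel)
open import Relation.Binary.Definitions using (Reflexive; Transitive)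
open import Relation.Binary.Structures using (IsStrictTotalOrder)
open import Relation.Binary.PropositionalEquality using (_≡_; _≢_; refl; sym; trans; cong; subst)

-- ∞ + 1 = ∞; prepending a move adds one to a capture time
suc∞ : ℕ∞ → ℕ∞
suc∞ (fin n) = fin (suc n)
suc∞ ∞       = ∞

≤∞-refl : Reflexive _≤∞_
≤∞-refl {fin n} = fin≤fin ≤-refl
≤∞-refl {∞}     = ∞ ≤∞∞

≤∞-trans : Transitive _≤∞_
≤∞-trans (fin≤fin p) (fin≤fin q) = fin≤fin (≤-trans p q)
≤∞-trans _           (_ ≤∞∞)     = _ ≤∞∞

≡⇒≤∞ : ∀ {a b} → a ≡ b → a ≤∞ b
≡⇒≤∞ refl = ≤∞-refl

_≤∞?_ : ∀ a b → Dec (a ≤∞ b)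
fin m ≤∞? fin n with m ≤? n
... | yes m≤n = yes (fin≤fin m≤n)
... | no  m≰n = no λ { (fin≤fin m≤n) → m≰n m≤n }
a     ≤∞? ∞     = yes (a ≤∞∞)
∞     ≤∞? fin n = no λ ()

-- ≤∞ is decidable, hence stable under double negation: this is what lets the
-- classical minimax reasoning below be carried out constructively.
≤∞-stable : ∀ {a b} → Stable (a ≤∞ b)
≤∞-stable {a} {b} = decidable-stable (a ≤∞? b)

suc∞-mono : ∀ {a b} → a ≤∞ b → suc∞ a ≤∞ suc∞ b
suc∞-mono (fin≤fin p) = fin≤fin (s≤s p)
suc∞-mono (fin _ ≤∞∞) = _ ≤∞∞
suc∞-mono (∞ ≤∞∞)     = _ ≤∞∞

suc∞-cancel : ∀ {a m} → suc∞ a ≤∞ fin (suc m) → a ≤∞ fin m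
suc∞-cancel {fin n} (fin≤fin (s≤s p)) = fin≤fin p

suc∞≰0 : ∀ {a} → ¬ (suc∞ a ≤∞ fin 0)
suc∞≰0 {fin n} (fin≤fin ())

suc≰ : ∀ {m} → ¬ (fin (suc m) ≤∞ fin m)
suc≰ (fin≤fin p) = 1+n≰n p

≰⇒suc≤ : ∀ {a m} → ¬ (a ≤∞ fin m) → fin (suc m) ≤∞ a
≰⇒suc≤ {fin n} {m} a≰m with n ≤? m
... | yes n≤m = ⊥-elim (a≰m (fin≤fin n≤m))
... | no  n≰m = fin≤fin (≰⇒> n≰m)
≰⇒suc≤ {∞} _ = _ ≤∞∞

suc≰⇒≤ : ∀ {a m} → ¬ (fin (suc m) ≤∞ a) → a ≤∞ fin m
suc≰⇒≤ {a} {m} m<a with a ≤∞? fin m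
... | yes a≤m = a≤m
... | no  a≰m = ⊥-elim (m<a (≰⇒suc≤ a≰m))

≤∞-byFiniteBounds : ∀ {a b} → (∀ m → b ≤∞ fin m → a ≤∞ fin m) → a ≤∞ b
≤∞-byFiniteBounds {b = fin m} bound = bound m ≤∞-refl
≤∞-byFiniteBounds {b = ∞}     _     = _ ≤∞∞

<∞ᵇ⇒≤∞ : ∀ a b → (a <∞ᵇ b) ≡ true → a ≤∞ b
<∞ᵇ⇒≤∞ (fin m) (fin n) lt = fin≤fin (<⇒≤ (<ᵇ⇒< m n (Equivalence.from T-≡ lt)))
<∞ᵇ⇒≤∞ (fin m) ∞       _  = _ ≤∞∞

≮∞ᵇ⇒≥∞ : ∀ a b → (a <∞ᵇ b) ≡ false → b ≤∞ a
≮∞ᵇ⇒≥∞ (fin m) (fin n) ≮ = fin≤fin (≮⇒≥ λ m<n → subst T ≮ (<⇒<ᵇ m<n))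
≮∞ᵇ⇒≥∞ ∞       b       _ = b ≤∞∞

≡∞ᵇ⇒≡ : ∀ a b → (a ≡∞ᵇ b) ≡ true → a ≡ b
≡∞ᵇ⇒≡ (fin m) (fin n) eq = cong fin (≡ᵇ⇒≡ m n (Equivalence.from T-≡ eq))
≡∞ᵇ⇒≡ ∞       ∞       _  = refl

glb-approx : ∀ {A : Set} {R : A → ℕ∞ → Set} {v m} → IsGLB R v → v ≤∞ fin m →
  ¬ ¬ (Σ A λ a → Σ ℕ∞ λ w → R a w × w ≤∞ fin m)
glb-approx (_ , greatest) v≤m none =
  suc≰ (≤∞-trans (greatest _ λ a w r → ≰⇒suc≤ λ w≤m → none (a , w , r , w≤m)) v≤m)

lub-approx : ∀ {A : Set} {R : A → ℕ∞ → Set} {v m} → IsLUB R v → fin (suc m) ≤∞ v →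
  ¬ ¬ (Σ A λ a → Σ ℕ∞ λ w → R a w × fin (suc m) ≤∞ w)
lub-approx (_ , least) m<v none =
  suc≰ (≤∞-trans m<v (least _ λ a w r → suc≰⇒≤ λ m<w → none (a , w , r , m<w)))

module Plays (G : GCR) where
  open GCR G

  shift : NS → RawStrat → RawStrat
  shift s σ h x = σ (s ∷ h) x

  positional : (NS → NS) → RawStrat
  positional a _ x = a x

  -- the first move of σ followed by σ' (which sees the history without s₀)
  splice : RawStrat → RawStrat → RawStrat
  splice σ σ' []      x = σ [] x
  splice σ σ' (_ ∷ h) x = σ' h x

  first : RawStrat → RawStrat → NS → NS
  first σ1 σ2 s = mover σ1 σ2 (owner s) [] s

  first-splice₁ : ∀ σ1 σ1' σ2 s → first (splice σ1 σ1') σ2 s ≡ first σ1 σ2 s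
  first-splice₁ σ1 σ1' σ2 (_ , _ , P1) = refl
  first-splice₁ σ1 σ1' σ2 (_ , _ , P2) = refl

  first-splice₂ : ∀ σ1 σ2 σ2' s → first σ1 (splice σ2 σ2') s ≡ first σ1 σ2 s
  first-splice₂ σ1 σ2 σ2' (_ , _ , P1) = refl
  first-splice₂ σ1 σ2 σ2' (_ , _ , P2) = refl

  shift-legal : ∀ {n σ} s → IsStrategy n σ → IsStrategy n (shift s σ)
  shift-legal s legal h = legal (s ∷ h)

  splice-legal : ∀ {n σ σ'} → IsStrategy n σ → IsStrategy n σ' → IsStrategy n (splice σ σ')
  splice-legal legal legal' []      = legal []
  splice-legal legal legal' (_ ∷ h) = legal' h

  -- some legal move out of every non-capture state (s itself at capture states)
  moveOut : ∀ s b → Sc s ≡ b → NS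
  moveOut s true  _  = s
  moveOut s false nc = proj₁ (N-nonempty s nc)

  anyMove : NS → NS
  anyMove s = moveOut s (Sc s) refl

  moveOut-legal : ∀ s b (sc : Sc s ≡ b) → Sc s ≡ false → N s (moveOut s b sc) ≡ true
  moveOut-legal s true  sc nc with () ← trans (sym sc) nc
  moveOut-legal s false sc _  = proj₂ (N-nonempty s sc)

  anyMove-legal : ∀ s → Sc s ≡ false → N s (anyMove s) ≡ true
  anyMove-legal s = moveOut-legal s (Sc s) refl

  anyStrategy-legal : ∀ {n} → IsStrategy n (positional anyMove)
  anyStrategy-legal h x _ nc = anyMove-legal x nc

  step-shift : ∀ σ1 σ2 s h y → step σ1 σ2 (s ∷ h) y ≡ step (shift s σ1) (shift s σ2) h y
  step-shift σ1 σ2 s h (_ , _ , P1) = refl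
  step-shift σ1 σ2 s h (_ , _ , P2) = refl

  playFrom-shift : ∀ σ1 σ2 s h x j →
    playFrom σ1 σ2 (s ∷ h) x j ≡ playFrom (shift s σ1) (shift s σ2) h x j
  playFrom-shift σ1 σ2 s h x      zero    = refl
  playFrom-shift σ1 σ2 s h τ      (suc j) = refl
  playFrom-shift σ1 σ2 s h (st y) (suc j) rewrite step-shift σ1 σ2 s h y =
    playFrom-shift σ1 σ2 s (h ++ [ y ]) _ j

  play-suc : ∀ σ1 σ2 s j → Sc s ≡ false →
    play σ1 σ2 s (suc j) ≡ play (shift s σ1) (shift s σ2) (first σ1 σ2 s) j
  play-suc σ1 σ2 s j nc with Sc s
  ... | false = playFrom-shift σ1 σ2 s [] (st (first σ1 σ2 s)) j

  captureTime-prepend : ∀ σ1 σ2 s t → Sc s ≡ false →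
    CaptureTime (shift s σ1) (shift s σ2) (first σ1 σ2 s) t → CaptureTime σ1 σ2 s (suc∞ t)
  captureTime-prepend σ1 σ2 s (fin k) nc (before , captured) =
    running , subst InSc (sym (play-suc σ1 σ2 s k nc)) captured
    where
    running : ∀ j → j < suc k → InSnc (play σ1 σ2 s j)
    running zero    _           = nc
    running (suc j) (s≤s j<k) = subst InSnc (sym (play-suc σ1 σ2 s j nc)) (before j j<k)
  captureTime-prepend σ1 σ2 s ∞ nc never = running
    where
    running : ∀ j → InSnc (play σ1 σ2 s j)
    running zero    = nc
    running (suc j) = subst InSnc (sym (play-suc σ1 σ2 s j nc)) (never j)

  captureTime-drop : ∀ σ1 σ2 s k → CaptureTime σ1 σ2 s (fin (suc k)) →
    Sc s ≡ false × CaptureTime (shift s σ1) (shift s σ2) (first σ1 σ2 s) (fin k)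
  captureTime-drop σ1 σ2 s k (before , captured) =
      nc
    , (λ j j<k → subst InSnc (play-suc σ1 σ2 s j nc) (before (suc j) (s≤s j<k)))
    , subst InSc (play-suc σ1 σ2 s k nc) captured
    where nc = before zero (s≤s z≤n)

  -- Existence of the capture time (under ¬¬: whether capture ever happens is
  -- not decidable).
  InSnc? : ∀ x → Dec (InSnc x)
  InSnc? (st y) with Sc y
  ... | true  = no λ ()
  ... | false = yes refl
  InSnc? τ = no λ ()

  Snc⇒¬Sc : ∀ x → InSnc x → ¬ InSc x
  Snc⇒¬Sc (st y) snc sc with Sc y
  Snc⇒¬Sc (st y) ()  sc | true
  Snc⇒¬Sc (st y) snc () | false

  ¬Snc⇒Sc : ∀ y → ¬ InSnc (st y) → InSc (st y)
  ¬Snc⇒Sc y ¬snc with Sc y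
  ... | true  = refl
  ... | false = ⊥-elim (¬snc refl)

  noJumpToτ : ∀ σ1 σ2 h x j → InSnc (playFrom σ1 σ2 h x j) → playFrom σ1 σ2 h x (suc j) ≢ τ
  noJumpToτ σ1 σ2 h (st y) zero    snc reachedτ with Sc y
  noJumpToτ σ1 σ2 h (st y) zero    ()  reachedτ | true
  noJumpToτ σ1 σ2 h (st y) zero    snc ()       | false
  noJumpToτ σ1 σ2 h (st y) (suc j) snc reachedτ =
    noJumpToτ σ1 σ2 (h ++ [ y ]) (step σ1 σ2 h y) j snc reachedτ

  firstExit : ∀ σ1 σ2 s j → (∀ i → i < j → InSnc (play σ1 σ2 s i)) →
    ¬ InSnc (play σ1 σ2 s j) → InSc (play σ1 σ2 s j)
  firstExit σ1 σ2 s j before ¬snc with play σ1 σ2 s j in eq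
  ... | st y = ¬Snc⇒Sc y ¬snc
  firstExit σ1 σ2 s zero    before ¬snc | τ with () ← eq
  firstExit σ1 σ2 s (suc i) before ¬snc | τ =
    ⊥-elim (noJumpToτ σ1 σ2 [] (st s) i (before i ≤-refl) eq)

  capturedOrRunning : ∀ σ1 σ2 s j →
    (∀ i → i < j → InSnc (play σ1 σ2 s i)) ⊎ Σ ℕ (λ k → CaptureTime σ1 σ2 s (fin k))
  capturedOrRunning σ1 σ2 s zero = inj₁ λ i ()
  capturedOrRunning σ1 σ2 s (suc j) with capturedOrRunning σ1 σ2 s j
  ... | inj₂ captured = inj₂ captured
  ... | inj₁ before with InSnc? (play σ1 σ2 s j)
  ...   | no ¬snc = inj₂ (j , before , firstExit σ1 σ2 s j before ¬snc)
  ...   | yes snc = inj₁ running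
    where
    running : ∀ i → i < suc j → InSnc (play σ1 σ2 s i)
    running i i<1+j with m<1+n⇒m<n∨m≡n i<1+j
    ... | inj₁ i<j  = before i i<j
    ... | inj₂ refl = snc

  captureTime-exists : ∀ σ1 σ2 s → ¬ ¬ Σ ℕ∞ (CaptureTime σ1 σ2 s)
  captureTime-exists σ1 σ2 s none = none (∞ , running)
    where
    running : ∀ j → InSnc (play σ1 σ2 s j)
    running j with capturedOrRunning σ1 σ2 s (suc j)
    ... | inj₁ before       = before j ≤-refl
    ... | inj₂ (k , capture) = ⊥-elim (none (fin k , capture))

  captureTime-≤ : ∀ σ1 σ2 s t k → CaptureTime σ1 σ2 s t → InSc (play σ1 σ2 s k) → t ≤∞ fin k
  captureTime-≤ σ1 σ2 s ∞ k never captured = ⊥-elim (Snc⇒¬Sc _ (never k) captured)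
  captureTime-≤ σ1 σ2 s (fin k') k (before , _) captured with k' ≤? k
  ... | yes k'≤k = fin≤fin k'≤k
  ... | no  k'≰k = ⊥-elim (Snc⇒¬Sc _ (before k (≰⇒> k'≰k)) captured)

  record IsPursuerPotential (a : NS → NS) (V : NS → ℕ∞) : Set where
    field
      pursuerMove : ∀ s → owner s ≡ P1 → Sc s ≡ false → suc∞ (V (a s)) ≤∞ V s
      evaderMove  : ∀ s → owner s ≡ P2 → Sc s ≡ false →
                    ∀ s' → N s s' ≡ true → suc∞ (V s') ≤∞ V s

  record IsEvaderPotential (b : NS → NS) (V : NS → ℕ∞) : Set where
    field
      atCapture   : ∀ s → Sc s ≡ true → V s ≤∞ fin 0
      pursuerMove : ∀ s → owner s ≡ P1 → Sc s ≡ false →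
                    ∀ s' → N s s' ≡ true → V s ≤∞ suc∞ (V s')
      evaderMove  : ∀ s → owner s ≡ P2 → Sc s ≡ false → V s ≤∞ suc∞ (V (b s))

  module _ {a V} (potential : IsPursuerPotential a V) where
    open IsPursuerPotential potential

    descends : ∀ {σ2} → IsStrategy P2 σ2 → ∀ s → Sc s ≡ false →
      suc∞ (V (first (positional a) σ2 s)) ≤∞ V s
    descends legal s@(_ , _ , P1) nc = pursuerMove s refl nc
    descends legal s@(_ , _ , P2) nc = evaderMove s refl nc _ (legal [] s refl nc)

    captureWithin : ∀ m s {σ2} → IsStrategy P2 σ2 → V s ≤∞ fin m →
      Σ ℕ λ k → k ≤ m × InSc (play (positional a) σ2 s k)
    captureWithin m s legal V≤m with Sc s in sc
    ... | true = 0 , z≤n , sc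
    captureWithin zero s legal V≤m | false =
      ⊥-elim (suc∞≰0 (≤∞-trans (descends legal s sc) V≤m))
    captureWithin (suc m) s {σ2} legal V≤m | false
      with captureWithin m (first (positional a) σ2 s) (shift-legal s legal)
                         (suc∞-cancel (≤∞-trans (descends legal s sc) V≤m))
    ... | k , k≤m , captured =
      suc k , s≤s k≤m , subst InSc (sym (play-suc (positional a) σ2 s k sc)) captured

    pursuerGuarantee : ∀ {σ2} → IsStrategy P2 σ2 → ∀ s t →
      CaptureTime (positional a) σ2 s t → t ≤∞ V s
    pursuerGuarantee legal s t capture = ≤∞-byFiniteBounds λ m V≤m →
      let (k , k≤m , captured) = captureWithin m s legal V≤m
      in  ≤∞-trans (captureTime-≤ _ _ s t k capture captured) (fin≤fin k≤m)

  module _ {b V} (potential : IsEvaderPotential b V) where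
    open IsEvaderPotential potential

    ascends : ∀ {σ1} → IsStrategy P1 σ1 → ∀ s → Sc s ≡ false →
      V s ≤∞ suc∞ (V (first σ1 (positional b) s))
    ascends legal s@(_ , _ , P1) nc = pursuerMove s refl nc _ (legal [] s refl nc)
    ascends legal s@(_ , _ , P2) nc = evaderMove s refl nc

    survivesUntil : ∀ k s {σ1} → IsStrategy P1 σ1 →
      CaptureTime σ1 (positional b) s (fin k) → V s ≤∞ fin k
    survivesUntil zero s legal (_ , captured) = atCapture s captured
    survivesUntil (suc k) s {σ1} legal capture =
      let (nc , capture') = captureTime-drop σ1 (positional b) s k capture
      in  ≤∞-trans (ascends legal s nc)
                   (suc∞-mono (survivesUntil k _ (shift-legal s legal) capture'))

    evaderGuarantee : ∀ {σ1} → IsStrategy P1 σ1 → ∀ s t →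
      CaptureTime σ1 (positional b) s t → V s ≤∞ t
    evaderGuarantee legal s (fin k) capture = survivesUntil k s legal capture
    evaderGuarantee legal s ∞       _       = _ ≤∞∞

module Selection (G : GCR) {_<ₒ_ : Rel (GCR.NS G) 0ℓ}
                 (ord : IsStrictTotalOrder _≡_ _<ₒ_) (V : GCR.NS G → ℕ∞) where
  open GCR G

  Decides : (ℕ∞ → ℕ∞ → Set) → (NS → NS → Bool) → Set
  Decides R beats = ∀ y b → (beats y b ≡ true  → R (V y) (V b))
                          × (beats y b ≡ false → R (V b) (V y))

  best-optimal : ∀ (R : ℕ∞ → ℕ∞ → Set) → Reflexive R → Transitive R →
    ∀ beats → Decides R beats →
    ∀ b ys → All (λ z → R (V (best ord V beats b ys)) (V z)) (b ∷ ys)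
  best-optimal R refl' trans' beats decides b []       = refl' ∷ []
  best-optimal R refl' trans' beats decides b (y ∷ ys) with beats y b in wins
  ... | true  with best-optimal R refl' trans' beats decides y ys
  ...   | p ∷ ps = trans' p (proj₁ (decides y b) wins) ∷ p ∷ ps
  best-optimal R refl' trans' beats decides b (y ∷ ys) | false
    with best-optimal R refl' trans' beats decides b ys
  ...   | p ∷ ps = p ∷ trans' p (proj₂ (decides y b) wins) ∷ ps

  best-preserves : ∀ (P : NS → Set) beats b ys → All P (b ∷ ys) → P (best ord V beats b ys)
  best-preserves P beats b []       (pb ∷ [])        = pb
  best-preserves P beats b (y ∷ ys) (pb ∷ py ∷ pys) with beats y b
  ... | true  = best-preserves P beats y ys (py ∷ pys)
  ... | false = best-preserves P beats b ys (pb ∷ pys)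

  allNS-complete : ∀ x → x ∈ allNS
  allNS-complete (a , b , P1) =
    ∈-cartesianProduct⁺ (∈-allFin a) (∈-cartesianProduct⁺ (∈-allFin b) (here refl))
  allNS-complete (a , b , P2) =
    ∈-cartesianProduct⁺ (∈-allFin a) (∈-cartesianProduct⁺ (∈-allFin b) (there (here refl)))

  successor∈candidates : ∀ s s' → N s s' ≡ true → s' ∈ filterᵇ (N s) allNS
  successor∈candidates s s' ns =
    ∈-filter⁺ (λ x → T? (N s x)) (allNS-complete s') (Equivalence.from T-≡ ns)

  argBest-optimal : ∀ (R : ℕ∞ → ℕ∞ → Set) → Reflexive R → Transitive R →
    ∀ beats → Decides R beats → ∀ s s' → N s s' ≡ true → R (V (argBest ord V beats s)) (V s')
  argBest-optimal R refl' trans' beats decides s s' ns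
    with filterᵇ (N s) allNS | successor∈candidates s s' ns
  ... | b ∷ ys | s'∈ = All.lookup (best-optimal R refl' trans' beats decides b ys) s'∈

  argBest-legal : ∀ beats s → Sc s ≡ false → N s (argBest ord V beats s) ≡ true
  argBest-legal beats s nc
    with filterᵇ (N s) allNS | all-filter (λ x → T? (N s x)) allNS
       | successor∈candidates s _ (proj₂ (N-nonempty s nc))
  ... | b ∷ ys | legal | _ = Equivalence.to T-≡ (best-preserves (λ y → T (N s y)) beats b ys legal)

  beatsMin-decides : Decides _≤∞_ (beatsMin ord V)
  beatsMin-decides y b = wins , loses
    where
    wins : beatsMin ord V y b ≡ true → V y ≤∞ V b
    wins w with V y <∞ᵇ V b in lt
    ... | true = <∞ᵇ⇒≤∞ _ _ lt
    ... | false with V y ≡∞ᵇ V b in eq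
    ...   | true = ≡⇒≤∞ (≡∞ᵇ⇒≡ _ _ eq)
    wins () | false | false
    loses : beatsMin ord V y b ≡ false → V b ≤∞ V y
    loses l with V y <∞ᵇ V b in lt
    loses () | true
    ... | false = ≮∞ᵇ⇒≥∞ _ _ lt

  beatsMax-decides : Decides (flip _≤∞_) (beatsMax ord V)
  beatsMax-decides y b = wins , loses
    where
    wins : beatsMax ord V y b ≡ true → V b ≤∞ V y
    wins w with V b <∞ᵇ V y in lt
    ... | true = <∞ᵇ⇒≤∞ _ _ lt
    ... | false with V y ≡∞ᵇ V b in eq
    ...   | true = ≡⇒≤∞ (sym (≡∞ᵇ⇒≡ _ _ eq))
    wins () | false | false
    loses : beatsMax ord V y b ≡ false → V y ≤∞ V b
    loses l with V b <∞ᵇ V y in lt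
    loses () | true
    ... | false = ≮∞ᵇ⇒≥∞ _ _ lt

  argmin-optimal : ∀ s s' → N s s' ≡ true → V (argBest ord V (beatsMin ord V) s) ≤∞ V s'
  argmin-optimal = argBest-optimal _≤∞_ ≤∞-refl ≤∞-trans _ beatsMin-decides

  argmax-optimal : ∀ s s' → N s s' ≡ true → V s' ≤∞ V (argBest ord V (beatsMax ord V) s)
  argmax-optimal = argBest-optimal (flip _≤∞_) ≤∞-refl (flip ≤∞-trans) _ beatsMax-decides

  σ̂1-legal : IsStrategy P1 (σ̂1 ord V)
  σ̂1-legal _ s _ nc = argBest-legal (beatsMin ord V) s nc

  σ̂2-legal : IsStrategy P2 (σ̂2 ord V)
  σ̂2-legal _ s _ nc = argBest-legal (beatsMax ord V) s nc

module Bellman (G : GCR) {_<ₒ_ : Rel (GCR.NS G) 0ℓ} (ord : IsStrictTotalOrder _≡_ _<ₒ_)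
               (T̂ : GCR.NS G → ℕ∞) (value : ∀ s → GCR.IsValue G s (T̂ s)) where
  open GCR G
  open Plays G
  open Selection G ord T̂
  open IsStrictTotalOrder ord using (_≟_)

  InfOverPursuers : RawStrat → NS → ℕ∞ → Set
  InfOverPursuers σ2 s = IsGLB (λ (σ1 : Strat P1) t → CaptureTime (proj₁ σ1) σ2 s t)

  SupOverEvaders : RawStrat → NS → ℕ∞ → Set
  SupOverEvaders σ1 s = IsLUB (λ (σ2 : Strat P2) t → CaptureTime σ1 (proj₁ σ2) s t)

  value-upper : ∀ s u → (∀ σ2 → IsStrategy P2 σ2 → ∀ w → InfOverPursuers σ2 s w → w ≤∞ u) →
    T̂ s ≤∞ u
  value-upper s u bound = proj₂ (proj₁ (value s)) u λ (σ2 , legal) → bound σ2 legal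

  value-lower : ∀ s u → (∀ σ1 → IsStrategy P1 σ1 → ∀ w → SupOverEvaders σ1 s w → u ≤∞ w) →
    u ≤∞ T̂ s
  value-lower s u bound = proj₂ (proj₂ (value s)) u λ (σ1 , legal) → bound σ1 legal

  -- Against σ2 from a non-capture s, the Pursuer may make σ1's first move and
  -- then play near-optimally from the successor s₁: the infimum is ≤ 1 + T̂ s₁.
  inf-after-first-move : ∀ s {σ1 σ2} → Sc s ≡ false → IsStrategy P1 σ1 → IsStrategy P2 σ2 →
    ∀ w → InfOverPursuers σ2 s w → w ≤∞ suc∞ (T̂ (first σ1 σ2 s))
  inf-after-first-move s {σ1} {σ2} nc legal₁ legal₂ w inf = ≤∞-byFiniteBounds bound
    where
    s₁ = first σ1 σ2 s
    continueWith : ∀ σ1' → IsStrategy P1 σ1' → ∀ t →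
      CaptureTime σ1' (shift s σ2) s₁ t → w ≤∞ suc∞ t
    continueWith σ1' legal' t capture =
      proj₁ inf (splice σ1 σ1' , splice-legal legal₁ legal') (suc∞ t)
        (captureTime-prepend (splice σ1 σ1') σ2 s t nc
          (subst (λ x → CaptureTime σ1' (shift s σ2) x t) (sym (first-splice₁ σ1 σ1' σ2 s)) capture))
    bound : ∀ m → suc∞ (T̂ s₁) ≤∞ fin m → w ≤∞ fin m
    bound zero    le = ⊥-elim (suc∞≰0 le)
    bound (suc m) le = ≤∞-stable λ w≰ →
      glb-approx (proj₂ (value s₁)) (suc∞-cancel le) λ ((σ1' , legal') , w₁ , sup , w₁≤m) →
      captureTime-exists σ1' (shift s σ2) s₁ λ (t , capture) →
      w≰ (≤∞-trans (continueWith σ1' legal' t capture)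
                   (suc∞-mono (≤∞-trans (proj₁ sup (shift s σ2 , shift-legal s legal₂) t capture) w₁≤m)))

  sup-after-first-move : ∀ s {σ1 σ2} → Sc s ≡ false → IsStrategy P1 σ1 → IsStrategy P2 σ2 →
    ∀ w → SupOverEvaders σ1 s w → suc∞ (T̂ (first σ1 σ2 s)) ≤∞ w
  sup-after-first-move s {σ1} {σ2} nc legal₁ legal₂ w sup = ≤∞-byFiniteBounds bound
    where
    s₁ = first σ1 σ2 s
    continueWith : ∀ σ2' → IsStrategy P2 σ2' → ∀ t →
      CaptureTime (shift s σ1) σ2' s₁ t → suc∞ t ≤∞ w
    continueWith σ2' legal' t capture =
      proj₁ sup (splice σ2 σ2' , splice-legal legal₂ legal') (suc∞ t)
        (captureTime-prepend σ1 (splice σ2 σ2') s t nc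
          (subst (λ x → CaptureTime (shift s σ1) σ2' x t) (sym (first-splice₂ σ1 σ2 σ2' s)) capture))
    bound : ∀ m → w ≤∞ fin m → suc∞ (T̂ s₁) ≤∞ fin m
    bound zero    w≤0 = ⊥-elim (captureTime-exists (shift s σ1) (shift s σ2) s₁ λ (t , capture) →
      suc∞≰0 (≤∞-trans (continueWith (shift s σ2) (shift-legal s legal₂) t capture) w≤0))
    bound (suc m) w≤m = suc∞-mono (≤∞-stable λ T̂≰m →
      lub-approx (proj₁ (value s₁)) (≰⇒suc≤ T̂≰m) λ ((σ2' , legal') , w' , inf , m<w') →
      captureTime-exists (shift s σ1) σ2' s₁ λ (t , capture) →
      suc≰ (≤∞-trans m<w' (≤∞-trans (proj₁ inf (shift s σ1 , shift-legal s legal₁) t capture)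
                                    (suc∞-cancel (≤∞-trans (continueWith σ2' legal' t capture) w≤m)))))

  goTo : NS → NS → RawStrat
  goTo s s' _ x with x ≟ s
  ... | yes _ = s'
  ... | no  _ = anyMove x

  goTo-legal : ∀ {n} s s' → N s s' ≡ true → IsStrategy n (goTo s s')
  goTo-legal s s' ns h x _ nc with x ≟ s
  ... | yes refl = ns
  ... | no  _    = anyMove-legal x nc

  goTo-start : ∀ s s' → goTo s s' [] s ≡ s'
  goTo-start s s' with s ≟ s
  ... | yes _   = refl
  ... | no  s≢s = ⊥-elim (s≢s refl)

  capture-value : ∀ s → Sc s ≡ true → T̂ s ≤∞ fin 0
  capture-value s sc = value-upper s (fin 0) λ _ _ w inf →
    proj₁ inf (positional anyMove , anyStrategy-legal) (fin 0) ((λ _ ()) , sc)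

  pursuer-anyMove : ∀ s → owner s ≡ P1 → Sc s ≡ false →
    ∀ s' → N s s' ≡ true → T̂ s ≤∞ suc∞ (T̂ s')
  pursuer-anyMove s@(_ , _ , P1) refl nc s' ns = value-upper s _ λ _ legal₂ w inf →
    subst (λ x → w ≤∞ suc∞ (T̂ x)) (goTo-start s s')
          (inf-after-first-move s nc (goTo-legal s s' ns) legal₂ w inf)

  pursuer-argmin : ∀ s → owner s ≡ P1 → Sc s ≡ false →
    suc∞ (T̂ (argBest ord T̂ (beatsMin ord T̂) s)) ≤∞ T̂ s
  pursuer-argmin s@(_ , _ , P1) refl nc = value-lower s _ λ σ1 legal₁ w sup →
    ≤∞-trans (suc∞-mono (argmin-optimal s (σ1 [] s) (legal₁ [] s refl nc)))
             (sup-after-first-move s nc legal₁ anyStrategy-legal w sup)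

  evader-anyMove : ∀ s → owner s ≡ P2 → Sc s ≡ false →
    ∀ s' → N s s' ≡ true → suc∞ (T̂ s') ≤∞ T̂ s
  evader-anyMove s@(_ , _ , P2) refl nc s' ns = value-lower s _ λ _ legal₁ w sup →
    subst (λ x → suc∞ (T̂ x) ≤∞ w) (goTo-start s s')
          (sup-after-first-move s nc legal₁ (goTo-legal s s' ns) w sup)

  evader-argmax : ∀ s → owner s ≡ P2 → Sc s ≡ false →
    T̂ s ≤∞ suc∞ (T̂ (argBest ord T̂ (beatsMax ord T̂) s))
  evader-argmax s@(_ , _ , P2) refl nc = value-upper s _ λ σ2 legal₂ w inf →
    ≤∞-trans (inf-after-first-move s nc anyStrategy-legal legal₂ w inf)
             (suc∞-mono (argmax-optimal s (σ2 [] s) (legal₂ [] s refl nc)))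

  value-pursuerPotential : IsPursuerPotential (argBest ord T̂ (beatsMin ord T̂)) T̂
  value-pursuerPotential = record
    { pursuerMove = pursuer-argmin ; evaderMove = evader-anyMove }

  value-evaderPotential : IsEvaderPotential (argBest ord T̂ (beatsMax ord T̂)) T̂
  value-evaderPotential = record
    { atCapture = capture-value ; pursuerMove = pursuer-anyMove ; evaderMove = evader-argmax }

proposition3p16 : (G : GCR) → GCR.Alternating G →
    {_<ₒ_ : Rel (GCR.NS G) 0ℓ} → (ord : IsStrictTotalOrder _≡_ _<ₒ_) →
    (T̂ : GCR.NS G → ℕ∞) → (∀ s → GCR.IsValue G s (T̂ s)) →
    (σ1 : GCR.RawStrat G) → GCR.IsStrategy G P1 σ1 →
    (σ2 : GCR.RawStrat G) → GCR.IsStrategy G P2 σ2 →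
    (s : GCR.NS G) →
    (∀ t t' → GCR.CaptureTime G (GCR.σ̂1 G ord T̂) (GCR.σ̂2 G ord T̂) s t →
              GCR.CaptureTime G σ1 (GCR.σ̂2 G ord T̂) s t' → t ≤∞ t')
    × (∀ t t' → GCR.CaptureTime G (GCR.σ̂1 G ord T̂) (GCR.σ̂2 G ord T̂) s t →
              GCR.CaptureTime G (GCR.σ̂1 G ord T̂) σ2 s t' → t' ≤∞ t)
proposition3p16 G _ ord T̂ value σ1 legal₁ σ2 legal₂ s =
    (λ t t' saddle deviation → ≤∞-trans (σ̂1-captures σ̂2-legal t saddle) (σ̂2-survives legal₁ t' deviation))
  , (λ t t' saddle deviation → ≤∞-trans (σ̂1-captures legal₂ t' deviation) (σ̂2-survives σ̂1-legal t saddle))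
  where
  open GCR G
  open Plays G
  open Selection G ord T̂
  open Bellman G ord T̂ value
  σ̂1-captures : ∀ {σ} → IsStrategy P2 σ → ∀ t → CaptureTime (σ̂1 ord T̂) σ s t → t ≤∞ T̂ s
  σ̂1-captures legal = pursuerGuarantee value-pursuerPotential legal s
  σ̂2-survives : ∀ {σ} → IsStrategy P1 σ → ∀ t → CaptureTime σ (σ̂2 ord T̂) s t → T̂ s ≤∞ t
  σ̂2-survives legal = evaderGuarantee value-evaderPotential legal s
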